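{- $\mathsf{IPT}^2_2$ is strongly computably reducible to $\mathsf{FUT}^{\leq 2}_2$ and to $\mathsf{HT}^{\leq 2}_4$.
   Context: $\mathbb{N}$ denotes the positive integers, $\mathbb{N}_0=\mathbb{N}\cup\{0\}$. $\mathsf{IPT}^2_2$: for every $c:[\mathbb{N}_0]^2\to 2$ there are infinite $H_1,H_2\subseteq\mathbb{N}$ such that $c(\{x_1,x_2\})$ is the same for all $x_1\in H_1$, $x_2\in H_2$ with $x_1<x_2$. $\mathsf{HT}^{\leq 2}_4$: for every $f:\mathbb{N}\to 4$ there is an infinite $H\subseteq\mathbb{N}$ such that $f$ is constant on the set of all $x$ and all $x+y$ with $x,y\in H$, $x\ne y$. $\mathsf{FUT}^{\leq 2}_2$: for every colouring of the finite subsets of $\mathbb{N}_0$ in 2 colours there is an infinite sequence $(X_i)$ of nonempty finite subsets of $\mathbb{N}$ with $\max X_i<\min X_j$ for $i<j$ such that all $X_i$ and all $X_i\cup X_j$ ($i\neq j$) have the same colour. $\mathsf{Q}$ is strongly computably reducible to $\mathsf{P}$ if for every instance $I$ of $\mathsf{Q}$ there is an instance $J$ of $\mathsf{P}$ computable from $I$ such that every solution of $J$ computes a solution of $I$. -}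

module Defs where

open import Data.Nat using (ℕ; zero; suc; _<_; _+_; ⌊_/2⌋)
open import Data.Bool using (Bool; true; false; _∨_; if_then_else_)
open import Data.Fin using (Fin; toℕ)
open import Data.Vec using (Vec; []; _∷_; lookup)
open import Data.Product using (Σ; ∃; _×_; _,_)
open import Relation.Binary.PropositionalEquality using (_≡_)
open import Relation.Nullary using (¬_)

-- Oracles are total functions ℕ → ℕ → ℕ (binary, for convenience of
-- encoding colourings of pairs, pairs of sets and sequences).
Oracle : Set
Oracle = ℕ → ℕ → ℕ

data Code : ℕ → Set where
  zeroᶜ : ∀ {k} → Code k
  succᶜ : Code 1
  projᶜ : ∀ {k} → Fin k → Code k
  orcᶜ  : Code 2
  compᶜ : ∀ {k m} → Code m → Vec (Code k) m → Code k
  precᶜ : ∀ {k} → Code k → Code (suc (suc k)) → Code (suc k)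
  muᶜ   : ∀ {k} → Code (suc k) → Code k

mutual
  data Eval (α : Oracle) : ∀ {k} → Code k → Vec ℕ k → ℕ → Set where
    ev-zero : ∀ {k} {xs : Vec ℕ k} → Eval α zeroᶜ xs 0
    ev-succ : ∀ {x} → Eval α succᶜ (x ∷ []) (suc x)
    ev-proj : ∀ {k} {i : Fin k} {xs} → Eval α (projᶜ i) xs (lookup xs i)
    ev-orc  : ∀ {x y} → Eval α orcᶜ (x ∷ y ∷ []) (α x y)
    ev-comp : ∀ {k m} {f : Code m} {gs : Vec (Code k) m} {xs ys z} →
              EvalAll α xs gs ys → Eval α f ys z → Eval α (compᶜ f gs) xs z
    ev-prec-z : ∀ {k} {f : Code k} {g : Code (suc (suc k))} {xs z} →
                Eval α f xs z → Eval α (precᶜ f g) (0 ∷ xs) z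
    ev-prec-s : ∀ {k} {f : Code k} {g : Code (suc (suc k))} {n xs r z} →
                Eval α (precᶜ f g) (n ∷ xs) r →
                Eval α g (n ∷ r ∷ xs) z →
                Eval α (precᶜ f g) (suc n ∷ xs) z
    ev-mu   : ∀ {k} {f : Code (suc k)} {xs n} →
              Eval α f (n ∷ xs) 0 →
              (∀ i → i < n → Σ ℕ (λ m → Eval α f (i ∷ xs) (suc m))) →
              Eval α (muᶜ f) xs n

  data EvalAll (α : Oracle) {k : ℕ} (xs : Vec ℕ k) : ∀ {m} → Vec (Code k) m → Vec ℕ m → Set where
    ev-[] : EvalAll α xs [] []
    ev-∷  : ∀ {m g y} {gs : Vec (Code k) m} {ys} →
            Eval α g xs y → EvalAll α xs gs ys → EvalAll α xs (g ∷ gs) (y ∷ ys)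

Computes : Oracle → Oracle → Set
Computes α β = Σ (Code 2) (λ e → ∀ x y → Eval α e (x ∷ y ∷ []) (β x y))

b2n : Bool → ℕ
b2n false = 0
b2n true  = 1

-- a colouring c of pairs: c x y (for x < y) is the colour of {x , y}
encPairCol : (ℕ → ℕ → Bool) → Oracle
encPairCol c x y = b2n (c x y)

encFun : (ℕ → ℕ) → Oracle
encFun f x _ = f x

encSet : (ℕ → Bool) → Oracle
encSet H x _ = b2n (H x)

encSetPair : (ℕ → Bool) → (ℕ → Bool) → Oracle
encSetPair H₁ H₂ zero    y = b2n (H₁ y)
encSetPair H₁ H₂ (suc _) y = b2n (H₂ y)

-- sets are characteristic functions ℕ → Bool (the argument ranges over ℕ₀)
Infinite : (ℕ → Bool) → Set
Infinite H = ∀ n → ∃ λ m → n < m × H m ≡ true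

PosSet : (ℕ → Bool) → Set
PosSet H = H 0 ≡ false

-- finite subsets of ℕ₀ are coded by their canonical index n = Σ_{x∈X} 2^x;
-- bit x n = true  iff  x ∈ (finite set with canonical index n)
odd? : ℕ → Bool
odd? zero = false
odd? (suc zero) = true
odd? (suc (suc n)) = odd? n

bit : ℕ → ℕ → Bool
bit zero    n = odd? n
bit (suc x) n = bit x ⌊ n /2⌋

IPTSol : (ℕ → ℕ → Bool) → (ℕ → Bool) → (ℕ → Bool) → Set
IPTSol c H₁ H₂ =
  Infinite H₁ × PosSet H₁ × Infinite H₂ × PosSet H₂ ×
  ∃ λ (k : Bool) → ∀ x₁ x₂ → H₁ x₁ ≡ true → H₂ x₂ ≡ true → x₁ < x₂ → c x₁ x₂ ≡ k

-- HT^{≤2}_4: instance f : ℕ → 4 (the value at 0 is irrelevant)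
HTSol : (ℕ → Fin 4) → (ℕ → Bool) → Set
HTSol f H =
  Infinite H × PosSet H ×
  ∃ λ (k : Fin 4) →
    (∀ x → H x ≡ true → f x ≡ k) ×
    (∀ x y → H x ≡ true → H y ≡ true → ¬ x ≡ y → f (x + y) ≡ k)

-- FUT^{≤2}_2: instance d colours finite subsets of ℕ₀ via canonical indices;
-- a solution is a sequence s of canonical indices of sets X_i
FUTSol : (ℕ → Bool) → (ℕ → ℕ) → Set
FUTSol d s =
  (∀ i → ¬ s i ≡ 0) ×
  (∀ i → bit 0 (s i) ≡ false) ×
  (∀ i j → i < j → ∀ x y → bit x (s i) ≡ true → bit y (s j) ≡ true → x < y) ×
  ∃ λ (k : Bool) →
    (∀ i → d (s i) ≡ k) ×
    (∀ i j → ¬ i ≡ j → ∀ u → (∀ x → bit x u ≡ (bit x (s i) ∨ bit x (s j))) → d u ≡ k)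

IPT≤scFUT : Set
IPT≤scFUT =
  ∀ (c : ℕ → ℕ → Bool) →
  Σ (ℕ → Bool) λ d →
    Computes (encPairCol c) (encSet d) ×
    (∀ s → FUTSol d s →
      Σ (ℕ → Bool) λ H₁ → Σ (ℕ → Bool) λ H₂ →
        IPTSol c H₁ H₂ × Computes (encFun s) (encSetPair H₁ H₂))

IPT≤scHT : Set
IPT≤scHT =
  ∀ (c : ℕ → ℕ → Bool) →
  Σ (ℕ → Fin 4) λ f →
    Computes (encPairCol c) (encFun (λ x → toℕ (f x))) ×
    (∀ H → HTSol f H →
      Σ (ℕ → Bool) λ H₁ → Σ (ℕ → Bool) λ H₂ →
        IPTSol c H₁ H₂ × Computes (encSet H) (encSetPair H₁ H₂))

-- Code a finite set by its canonical index and colour it by c (min, max). If X₀ < X₁ < ⋯ are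
-- nonempty blocks such that this colouring takes one value on each Xᵢ and on each Xᵢ ∪ Xⱼ,
-- then, since min (Xᵢ ∪ Xⱼ) = min Xᵢ and max (Xᵢ ∪ Xⱼ) = max Xⱼ for i < j, the sets
-- H₁ = {min Xᵢ} and H₂ = {max Xⱼ} solve IPT²₂ for c, and they are computable from the blocks.
-- A FUT solution for the min-max colouring is such a sequence of blocks. For HT, note that the
-- canonical index of a union of separated sets is the sum of the indices, and colour n by
-- c (min, max) together with the parity of min n. If two elements of an HT solution had the same
-- minimum l and the same bit at l + 1, their sum would have minimum l + 1, of the other parity;
-- as three numbers cannot pairwise differ in one bit, the minima are unbounded on the solution,
-- which therefore computes a block sequence by searching for an element whose minimum exceeds
-- the maximum of the previous block.

module Submission where

open import Defs
open import Data.Nat using (ℕ; zero; suc; pred; _<_; _≤_; _+_; _∸_; ⌊_/2⌋; z≤n; s≤s; s≤s⁻¹; _≡ᵇ_; _<ᵇ_)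
open import Data.Nat.Properties
open import Data.Bool using (Bool; true; false; not; _∧_; _∨_; _xor_; if_then_else_)
open import Data.Bool.Properties using (T-≡; not-¬; xor-same; ∨-zeroʳ)
open import Data.Fin using (Fin; toℕ) renaming (zero to fzero; suc to fsuc)
open import Data.Vec using (Vec; []; _∷_; lookup)
open import Data.Product using (Σ; ∃; _×_; _,_; proj₁; proj₂)
open import Data.Sum using (_⊎_; inj₁; inj₂)
open import Data.Empty using (⊥; ⊥-elim)
open import Function.Bundles using (Equivalence)
open import Relation.Binary.PropositionalEquality

-- Computability relative to an oracle

Computable : Oracle → (k : ℕ) → (Vec ℕ k → ℕ) → Set
Computable α k g = Σ (Code k) λ e → ∀ xs → Eval α e xs (g xs)

AllComputable : Oracle → (k m : ℕ) → (Vec ℕ k → Vec ℕ m) → Set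
AllComputable α k m gs = Σ (Vec (Code k) m) λ es → ∀ xs → EvalAll α xs es (gs xs)

primRec : ∀ {k} → (Vec ℕ k → ℕ) → (Vec ℕ (suc (suc k)) → ℕ) → Vec ℕ (suc k) → ℕ
primRec f g (zero  ∷ xs) = f xs
primRec f g (suc n ∷ xs) = g (n ∷ primRec f g (n ∷ xs) ∷ xs)

primRec-unfold : ∀ {k f g} (h : ℕ → Vec ℕ k → ℕ) → (∀ xs → h 0 xs ≡ f xs) →
                 (∀ n xs → h (suc n) xs ≡ g (n ∷ h n xs ∷ xs)) → ∀ n xs → h n xs ≡ primRec f g (n ∷ xs)
primRec-unfold h base step zero    xs = base xs
primRec-unfold {g = g} h base step (suc n) xs =
  trans (step n xs) (cong (λ r → g (n ∷ r ∷ xs)) (primRec-unfold h base step n xs))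

app₁ : (ℕ → ℕ) → Vec ℕ 1 → ℕ
app₁ f (x ∷ []) = f x

app₂ : (ℕ → ℕ → ℕ) → Vec ℕ 2 → ℕ
app₂ f (x ∷ y ∷ []) = f x y

app₃ : (ℕ → ℕ → ℕ → ℕ) → Vec ℕ 3 → ℕ
app₃ f (x ∷ y ∷ z ∷ []) = f x y z

Computable₁ : Oracle → (ℕ → ℕ) → Set
Computable₁ α f = Computable α 1 (app₁ f)

Computable₂ : Oracle → (ℕ → ℕ → ℕ) → Set
Computable₂ α f = Computable α 2 (app₂ f)

Computable₃ : Oracle → (ℕ → ℕ → ℕ → ℕ) → Set
Computable₃ α f = Computable α 3 (app₃ f)

ComputableRel : Oracle → (ℕ → ℕ → Bool) → Set
ComputableRel α P = Computable₂ α (λ x y → b2n (P x y))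

computable₂⇒computes : ∀ {α β} → Computable₂ α β → Computes α β
computable₂⇒computes (e , ev) = e , λ x y → ev (x ∷ y ∷ [])

module _ {α : Oracle} where

  computable-ext : ∀ {k g h} → Computable α k g → (∀ xs → g xs ≡ h xs) → Computable α k h
  computable-ext (e , ev) g≗h = e , λ xs → subst (Eval α e xs) (g≗h xs) (ev xs)

  zero-computable : ∀ {k} → Computable α k (λ _ → 0)
  zero-computable = zeroᶜ , λ _ → ev-zero

  suc-computable : Computable₁ α suc
  suc-computable = succᶜ , λ { (x ∷ []) → ev-succ }

  proj-computable : ∀ {k} (i : Fin k) → Computable α k (λ xs → lookup xs i)
  proj-computable i = projᶜ i , λ _ → ev-proj

  oracle-computable : Computable₂ α α
  oracle-computable = orcᶜ , λ { (x ∷ y ∷ []) → ev-orc }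

  []-computable : ∀ {k} → AllComputable α k 0 (λ _ → [])
  []-computable = [] , λ _ → ev-[]

  ∷-computable : ∀ {k m g gs} → Computable α k g → AllComputable α k m gs →
                 AllComputable α k (suc m) (λ xs → g xs ∷ gs xs)
  ∷-computable (e , ev) (es , evs) = e ∷ es , λ xs → ev-∷ (ev xs) (evs xs)

  ∘-computable : ∀ {k m f gs} → Computable α m f → AllComputable α k m gs →
                 Computable α k (λ xs → f (gs xs))
  ∘-computable (e , ev) (es , evs) = compᶜ e es , λ xs → ev-comp (evs xs) (ev _)

  primRec-computable : ∀ {k f g} → Computable α k f → Computable α (suc (suc k)) g →
                       Computable α (suc k) (primRec f g)
  primRec-computable {f = f} {g} (e , ev) (d , dv) = precᶜ e d , go
    where
    go : ∀ xs → Eval α (precᶜ e d) xs (primRec f g xs)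
    go (zero  ∷ xs) = ev-prec-z (ev xs)
    go (suc n ∷ xs) = ev-prec-s (go (n ∷ xs)) (dv _)

  minimise-computable : ∀ {k g} → Computable α (suc k) g → (n : Vec ℕ k → ℕ) →
                        (∀ xs → g (n xs ∷ xs) ≡ 0) → (∀ xs i → i < n xs → g (i ∷ xs) ≢ 0) →
                        Computable α k n
  minimise-computable {g = g} (e , ev) n root below = muᶜ e , λ xs →
      ev-mu (subst (Eval α e _) (root xs) (ev _)) (λ i i<n → positive (g (i ∷ xs)) refl (below xs i i<n))
    where
    positive : ∀ {xs i} r → g (i ∷ xs) ≡ r → r ≢ 0 → Σ ℕ λ m → Eval α e (i ∷ xs) (suc m)
    positive zero    _  r≢0 = ⊥-elim (r≢0 refl)
    positive (suc m) eq _   = m , subst (Eval α e _) eq (ev _)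

  compose₁ : ∀ {k f g} → Computable₁ α f → Computable α k g → Computable α k (λ xs → f (g xs))
  compose₁ F G = ∘-computable F (∷-computable G []-computable)

  compose₂ : ∀ {k f g h} → Computable₂ α f → Computable α k g → Computable α k h →
             Computable α k (λ xs → f (g xs) (h xs))
  compose₂ F G H = ∘-computable F (∷-computable G (∷-computable H []-computable))

  compose₃ : ∀ {k f g h i} → Computable₃ α f → Computable α k g → Computable α k h → Computable α k i →
             Computable α k (λ xs → f (g xs) (h xs) (i xs))
  compose₃ F G H I = ∘-computable F (∷-computable G (∷-computable H (∷-computable I []-computable)))

  ∘₁-computable : ∀ {f g} → Computable₁ α f → Computable₁ α g → Computable₁ α (λ x → f (g x))
  ∘₁-computable F G = computable-ext (compose₁ F G) λ { (x ∷ []) → refl }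

  π₀ : ∀ {k} → Computable α (suc k) (λ xs → lookup xs fzero)
  π₀ = proj-computable fzero

  π₁ : ∀ {k} → Computable α (suc (suc k)) (λ xs → lookup xs (fsuc fzero))
  π₁ = proj-computable (fsuc fzero)

  π₂ : ∀ {k} → Computable α (suc (suc (suc k))) (λ xs → lookup xs (fsuc (fsuc fzero)))
  π₂ = proj-computable (fsuc (fsuc fzero))

  recursion₁-computable : ∀ {b g} (h : ℕ → ℕ) → Computable α 0 b → Computable α 2 g →
                          h 0 ≡ b [] → (∀ n → h (suc n) ≡ g (n ∷ h n ∷ [])) → Computable₁ α h
  recursion₁-computable h B G base step = computable-ext (primRec-computable B G) λ { (n ∷ []) →
    sym (primRec-unfold (λ n _ → h n) (λ { [] → base }) (λ { n [] → step n }) n []) }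

  recursion₂-computable : ∀ {b g} (h : ℕ → ℕ → ℕ) → Computable α 1 b → Computable α 3 g →
                          (∀ y → h 0 y ≡ b (y ∷ [])) → (∀ n y → h (suc n) y ≡ g (n ∷ h n y ∷ y ∷ [])) →
                          Computable₂ α h
  recursion₂-computable h B G base step = computable-ext (primRec-computable B G) λ { (n ∷ y ∷ []) →
    sym (primRec-unfold (λ n → app₁ (h n)) (λ { (y ∷ []) → base y }) (λ { n (y ∷ []) → step n y }) n (y ∷ [])) }

-- Arithmetic and bounded search

isZero : ℕ → ℕ
isZero zero    = 1
isZero (suc _) = 0

ifNonzero : ℕ → ℕ → ℕ → ℕ
ifNonzero zero    u v = v
ifNonzero (suc _) u v = u

ifNonzero-b2n : ∀ q {u v : ℕ} → ifNonzero (b2n q) u v ≡ (if q then u else v)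
ifNonzero-b2n false = refl
ifNonzero-b2n true  = refl

b2n-odd?-suc : ∀ n → b2n (odd? (suc n)) ≡ isZero (b2n (odd? n))
b2n-odd?-suc zero          = refl
b2n-odd?-suc (suc zero)    = refl
b2n-odd?-suc (suc (suc n)) = b2n-odd?-suc n

⌊suc/2⌋≡⌊/2⌋+odd : ∀ n → ⌊ suc n /2⌋ ≡ ⌊ n /2⌋ + b2n (odd? n)
⌊suc/2⌋≡⌊/2⌋+odd zero          = refl
⌊suc/2⌋≡⌊/2⌋+odd (suc zero)    = refl
⌊suc/2⌋≡⌊/2⌋+odd (suc (suc n)) = cong suc (⌊suc/2⌋≡⌊/2⌋+odd n)

b2n-<ᵇ : ∀ m n → b2n (m <ᵇ n) ≡ isZero (suc m ∸ n)
b2n-<ᵇ zero    zero    = refl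
b2n-<ᵇ zero    (suc n) = cong isZero (sym (0∸n≡0 n))
b2n-<ᵇ (suc m) zero    = refl
b2n-<ᵇ (suc m) (suc n) = b2n-<ᵇ m n

b2n-≡ᵇ : ∀ m n → b2n (m ≡ᵇ n) ≡ isZero ((m ∸ n) + (n ∸ m))
b2n-≡ᵇ zero    zero    = refl
b2n-≡ᵇ zero    (suc n) = refl
b2n-≡ᵇ (suc m) zero    = refl
b2n-≡ᵇ (suc m) (suc n) = b2n-≡ᵇ m n

halve^ : ℕ → ℕ → ℕ
halve^ zero    n = n
halve^ (suc x) n = ⌊ halve^ x n /2⌋

halve^-⌊/2⌋ : ∀ x n → halve^ x ⌊ n /2⌋ ≡ ⌊ halve^ x n /2⌋
halve^-⌊/2⌋ zero    n = refl
halve^-⌊/2⌋ (suc x) n = cong ⌊_/2⌋ (halve^-⌊/2⌋ x n)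

bit≡odd?-halve^ : ∀ x n → bit x n ≡ odd? (halve^ x n)
bit≡odd?-halve^ zero    n = refl
bit≡odd?-halve^ (suc x) n = trans (bit≡odd?-halve^ x ⌊ n /2⌋) (cong odd? (halve^-⌊/2⌋ x n))

-- least P b is the least x < b with P x, and b if there is none; greatest P b is the
-- greatest such x, and 0 if there is none.
least : (ℕ → Bool) → ℕ → ℕ
least P zero    = 0
least P (suc b) = if P (least P b) then least P b else suc (least P b)

greatest : (ℕ → Bool) → ℕ → ℕ
greatest P zero    = 0
greatest P (suc b) = if P b then b else greatest P b

any< : (ℕ → Bool) → ℕ → Bool
any< P zero    = false
any< P (suc b) = P b ∨ any< P b

true≢false : true ≢ false
true≢false ()

least-sound : ∀ (P : ℕ → Bool) b → least P b < b → P (least P b) ≡ true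
least-sound P (suc b) with P (least P b) in eq
... | true  = λ _ → eq
... | false = λ lt → ⊥-elim (true≢false (trans (sym (least-sound P b (s≤s⁻¹ lt))) eq))

least-minimal : ∀ (P : ℕ → Bool) b y → y < least P b → P y ≡ false
least-minimal P (suc b) y with P (least P b) in eq
... | true  = least-minimal P b y
... | false = λ lt → below (m<1+n⇒m<n∨m≡n lt)
  where
  below : y < least P b ⊎ y ≡ least P b → P y ≡ false
  below (inj₁ lt) = least-minimal P b y lt
  below (inj₂ refl) = eq

least-≤ : ∀ (P : ℕ → Bool) b {y} → P y ≡ true → least P b ≤ y
least-≤ P b {y} Py = ≮⇒≥ λ lt → true≢false (trans (sym Py) (least-minimal P b y lt))

least-found : ∀ (P : ℕ → Bool) {b y} → P y ≡ true → y < b → P (least P b) ≡ true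
least-found P {b} Py y<b = least-sound P b (≤-<-trans (least-≤ P b Py) y<b)

greatest-≥ : ∀ (P : ℕ → Bool) {b y} → P y ≡ true → y < b → y ≤ greatest P b
greatest-≥ P {suc b} {y} Py y<b with P b in eq | m<1+n⇒m<n∨m≡n y<b
... | true  | _         = s≤s⁻¹ y<b
... | false | inj₁ y<b′ = greatest-≥ P Py y<b′
... | false | inj₂ refl = ⊥-elim (true≢false (trans (sym Py) eq))

greatest-found : ∀ (P : ℕ → Bool) {b y} → P y ≡ true → y < b → P (greatest P b) ≡ true
greatest-found P {suc b} {y} Py y<b with P b in eq | m<1+n⇒m<n∨m≡n y<b
... | true  | _         = eq
... | false | inj₁ y<b′ = greatest-found P Py y<b′
... | false | inj₂ refl = ⊥-elim (true≢false (trans (sym Py) eq))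

any<-intro : ∀ (P : ℕ → Bool) {b i} → P i ≡ true → i < b → any< P b ≡ true
any<-intro P {suc b} {i} Pi i<b with P b in eq | m<1+n⇒m<n∨m≡n i<b
... | true  | _         = refl
... | false | inj₁ i<b′ = any<-intro P Pi i<b′
... | false | inj₂ refl = ⊥-elim (true≢false (trans (sym Pi) eq))

any<-elim : ∀ (P : ℕ → Bool) b → any< P b ≡ true → ∃ λ i → P i ≡ true
any<-elim P (suc b) any with P b in eq
... | true  = b , eq
... | false = any<-elim P b any

module _ {α : Oracle} where

  id-computable : Computable₁ α (λ x → x)
  id-computable = computable-ext π₀ λ { (x ∷ []) → refl }

  one-computable : ∀ {k} → Computable α k (λ _ → 1)
  one-computable = compose₁ suc-computable zero-computable

  isZero-computable : Computable₁ α isZero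
  isZero-computable = recursion₁-computable isZero one-computable zero-computable refl (λ _ → refl)

  ifNonzero-computable : Computable₃ α ifNonzero
  ifNonzero-computable = computable-ext (primRec-computable π₁ π₂) λ where
    (zero  ∷ u ∷ v ∷ []) → refl
    (suc _ ∷ u ∷ v ∷ []) → refl

  if-computable : ∀ {k} {q : Vec ℕ k → Bool} {u v} → Computable α k (λ xs → b2n (q xs)) →
                  Computable α k u → Computable α k v → Computable α k (λ xs → if q xs then u xs else v xs)
  if-computable {q = q} Q U V = computable-ext (compose₃ ifNonzero-computable Q U V) λ xs → ifNonzero-b2n (q xs)

  ∧-computable : ∀ {k} {p q : Vec ℕ k → Bool} → Computable α k (λ xs → b2n (p xs)) →
                 Computable α k (λ xs → b2n (q xs)) → Computable α k (λ xs → b2n (p xs ∧ q xs))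
  ∧-computable {p = p} P Q = computable-ext (if-computable P Q zero-computable) λ xs → b2n-∧ (p xs)
    where
    b2n-∧ : ∀ a {b} → (if a then b2n b else 0) ≡ b2n (a ∧ b)
    b2n-∧ false = refl
    b2n-∧ true  = refl

  pred-computable : Computable₁ α pred
  pred-computable = recursion₁-computable pred zero-computable π₀ refl (λ _ → refl)

  +-computable : Computable₂ α _+_
  +-computable = recursion₂-computable _+_ id-computable (compose₁ suc-computable π₁) (λ _ → refl) (λ _ _ → refl)

  ∸-computable : Computable₂ α _∸_
  ∸-computable = computable-ext (compose₂ flipped π₁ π₀) λ { (x ∷ y ∷ []) → refl }
    where
    flipped : Computable₂ α (λ n y → y ∸ n)
    flipped = recursion₂-computable (λ n y → y ∸ n) id-computable (compose₁ pred-computable π₁)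
                (λ _ → refl) (λ n y → sym (pred[m∸n]≡m∸[1+n] y n))

  <ᵇ-computable : ComputableRel α _<ᵇ_
  <ᵇ-computable = computable-ext (compose₁ isZero-computable (compose₂ ∸-computable (compose₁ suc-computable π₀) π₁))
                    λ { (x ∷ y ∷ []) → sym (b2n-<ᵇ x y) }

  ≡ᵇ-computable : ComputableRel α _≡ᵇ_
  ≡ᵇ-computable = computable-ext
    (compose₁ isZero-computable (compose₂ +-computable (compose₂ ∸-computable π₀ π₁) (compose₂ ∸-computable π₁ π₀)))
    λ { (x ∷ y ∷ []) → sym (b2n-≡ᵇ x y) }

  odd?-computable : Computable₁ α (λ n → b2n (odd? n))
  odd?-computable = recursion₁-computable (λ n → b2n (odd? n)) zero-computable (compose₁ isZero-computable π₁)
                      refl b2n-odd?-suc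

  ⌊/2⌋-computable : Computable₁ α ⌊_/2⌋
  ⌊/2⌋-computable = recursion₁-computable ⌊_/2⌋ zero-computable
                      (compose₂ +-computable π₁ (compose₁ odd?-computable π₀)) refl ⌊suc/2⌋≡⌊/2⌋+odd

  halve^-computable : Computable₂ α halve^
  halve^-computable = recursion₂-computable halve^ id-computable (compose₁ ⌊/2⌋-computable π₁)
                        (λ _ → refl) (λ _ _ → refl)

  bit-computable : ComputableRel α bit
  bit-computable = computable-ext (compose₁ odd?-computable halve^-computable)
                     λ { (x ∷ n ∷ []) → cong b2n (sym (bit≡odd?-halve^ x n)) }

  module _ {P : ℕ → ℕ → Bool} (P-computable : ComputableRel α P) where

    least-computable : Computable₂ α (λ b y → least (λ x → P x y) b)
    least-computable = recursion₂-computable (λ b y → least (λ x → P x y) b) zero-computable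
      (if-computable (compose₂ P-computable π₁ π₂) π₁ (compose₁ suc-computable π₁)) (λ _ → refl) (λ _ _ → refl)

    greatest-computable : Computable₂ α (λ b y → greatest (λ x → P x y) b)
    greatest-computable = recursion₂-computable (λ b y → greatest (λ x → P x y) b) zero-computable
      (if-computable (compose₂ P-computable π₀ π₂) π₀ π₁) (λ _ → refl) (λ _ _ → refl)

    any<-computable : ComputableRel α (λ b y → any< (λ x → P x y) b)
    any<-computable = recursion₂-computable (λ b y → b2n (any< (λ x → P x y) b)) zero-computable
      (if-computable (compose₂ P-computable π₀ π₂) one-computable π₁) (λ _ → refl) (λ b y → b2n-∨ (P b y))
      where
      b2n-∨ : ∀ a {b} → b2n (a ∨ b) ≡ (if a then 1 else b2n b)
      b2n-∨ false = refl
      b2n-∨ true  = refl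

  search-computable : ∀ {P : ℕ → ℕ → Bool} → ComputableRel α P → (n : ℕ → ℕ) →
                      (∀ y → P (n y) y ≡ true) → (∀ y i → i < n y → P i y ≡ false) → Computable₁ α n
  search-computable {P} P-computable n found below =
    minimise-computable (compose₁ isZero-computable P-computable) (app₁ n)
      (λ { (y ∷ []) → cong (λ b → isZero (b2n b)) (found y) })
      (λ { (y ∷ []) i i<n → subst (λ b → isZero (b2n b) ≢ 0) (sym (below y i i<n)) λ () })

-- Finite sets coded by canonical indices

-- A record rather than the bare equation, so that x and n can be inferred from a membership proof.
record _∈_ (x n : ℕ) : Set where
  constructor member
  field bit-true : bit x n ≡ true

open _∈_

bit-0 : ∀ x → bit x 0 ≡ false
bit-0 zero    = refl
bit-0 (suc x) = bit-0 x

∈⇒< : ∀ {x n} → x ∈ n → x < n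
∈⇒< {zero}  {suc n} _ = s≤s z≤n
∈⇒< {suc x} {zero}  (member b) = ⊥-elim (true≢false (trans (sym b) (bit-0 x)))
∈⇒< {suc x} {suc n} (member b) = s≤s (≤-trans (∈⇒< (member b)) (s≤s⁻¹ (⌊n/2⌋<n n)))

nonzero⇒∈ : ∀ {n} → n ≢ 0 → ∃ λ x → x ∈ n
nonzero⇒∈ {n} = go n ≤-refl
  where
  go : ∀ {n} fuel → n ≤ fuel → n ≢ 0 → ∃ λ x → x ∈ n
  go {zero}        _          _        n≢0 = ⊥-elim (n≢0 refl)
  go {suc zero}    _          _        _   = 0 , member refl
  go {suc (suc n)} (suc fuel) (s≤s le) _   with go fuel (≤-trans (s≤s (⌊n/2⌋≤n n)) le) (λ ())
  ... | x , member b = suc x , member b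

lowest : ℕ → ℕ
lowest n = least (λ x → bit x n) (suc n)

highest : ℕ → ℕ
highest n = greatest (λ x → bit x n) (suc n)

lowest-≤ : ∀ {x n} → x ∈ n → lowest n ≤ x
lowest-≤ {n = n} x∈n = least-≤ (λ x → bit x n) (suc n) (bit-true x∈n)

lowest-∈ : ∀ {x n} → x ∈ n → lowest n ∈ n
lowest-∈ {n = n} x∈n = member (least-found (λ x → bit x n) (bit-true x∈n) (m<n⇒m<1+n (∈⇒< x∈n)))

<lowest⇒∉ : ∀ {y n} → y < lowest n → bit y n ≡ false
<lowest⇒∉ {y} {n} = least-minimal (λ x → bit x n) (suc n) y

≤highest : ∀ {x n} → x ∈ n → x ≤ highest n
≤highest {n = n} x∈n = greatest-≥ (λ x → bit x n) (bit-true x∈n) (m<n⇒m<1+n (∈⇒< x∈n))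

highest-∈ : ∀ {x n} → x ∈ n → highest n ∈ n
highest-∈ {n = n} x∈n = member (greatest-found (λ x → bit x n) (bit-true x∈n) (m<n⇒m<1+n (∈⇒< x∈n)))

lowest≤highest : ∀ {x n} → x ∈ n → lowest n ≤ highest n
lowest≤highest x∈n = ≤highest (lowest-∈ x∈n)

module _ {α : Oracle} where

  lowest-computable : Computable₁ α lowest
  lowest-computable = computable-ext (compose₂ (least-computable bit-computable) (compose₁ suc-computable π₀) π₀)
                        λ { (n ∷ []) → refl }

  highest-computable : Computable₁ α highest
  highest-computable = computable-ext (compose₂ (greatest-computable bit-computable) (compose₁ suc-computable π₀) π₀)
                         λ { (n ∷ []) → refl }

odd?-suc : ∀ n → odd? (suc n) ≡ not (odd? n)
odd?-suc zero          = refl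
odd?-suc (suc zero)    = refl
odd?-suc (suc (suc n)) = odd?-suc n

odd?-+ : ∀ m n → odd? (m + n) ≡ odd? m xor odd? n
odd?-+ zero          n = refl
odd?-+ (suc zero)    n = odd?-suc n
odd?-+ (suc (suc m)) n = odd?-+ m n

⌊+/2⌋-even : ∀ m {n} → odd? n ≡ false → ⌊ (m + n) /2⌋ ≡ ⌊ m /2⌋ + ⌊ n /2⌋
⌊+/2⌋-even zero          _ = refl
⌊+/2⌋-even (suc zero)    {n} even rewrite ⌊suc/2⌋≡⌊/2⌋+odd n | even = +-identityʳ _
⌊+/2⌋-even (suc (suc m)) even = cong suc (⌊+/2⌋-even m even)

⌊+/2⌋-odd : ∀ m {n} → odd? m ≡ true → odd? n ≡ true → ⌊ (m + n) /2⌋ ≡ suc (⌊ m /2⌋ + ⌊ n /2⌋)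
⌊+/2⌋-odd (suc zero)    {n} _ odd rewrite ⌊suc/2⌋≡⌊/2⌋+odd n | odd = +-comm _ 1
⌊+/2⌋-odd (suc (suc m)) oddm oddn = cong suc (⌊+/2⌋-odd m oddm oddn)

∈-⌊/2⌋ : ∀ {x n} → x ∈ ⌊ n /2⌋ → suc x ∈ n
∈-⌊/2⌋ (member x∈) = member x∈

bit-+-split : ∀ L {a b} → (∀ {x} → x ∈ a → x < L) → (∀ {y} → y ∈ b → L ≤ y) →
              ∀ x → bit x (a + b) ≡ (bit x a ∨ bit x b)
bit-+-split zero {zero}  _   _ x rewrite bit-0 x = refl
bit-+-split zero {suc a} a<0 _ x with () ← a<0 (proj₂ (nonzero⇒∈ {suc a} (λ ())))
bit-+-split (suc L) {a} {b} a<L L≤b = split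
  where
  b-even : odd? b ≡ false
  b-even with odd? b in eq
  ... | false = refl
  ... | true  with () ← L≤b {0} (member eq)
  split : ∀ x → bit x (a + b) ≡ (bit x a ∨ bit x b)
  split zero rewrite odd?-+ a b | b-even with odd? a
  ... | false = refl
  ... | true  = refl
  split (suc x) = trans (cong (bit x) (⌊+/2⌋-even a b-even))
                        (bit-+-split L (λ x∈ → s≤s⁻¹ (a<L (∈-⌊/2⌋ x∈))) (λ y∈ → s≤s⁻¹ (L≤b (∈-⌊/2⌋ y∈))) x)

_≺_ : ℕ → ℕ → Set
a ≺ b = ∀ {x y} → x ∈ a → y ∈ b → x < y

bit-+ : ∀ {a b y} → a ≺ b → y ∈ b → ∀ x → bit x (a + b) ≡ (bit x a ∨ bit x b)
bit-+ {b = b} a≺b y∈b = bit-+-split (lowest b) (λ x∈a → a≺b x∈a (lowest-∈ y∈b)) lowest-≤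

∈-+ˡ : ∀ {a b x y} → a ≺ b → y ∈ b → x ∈ a → x ∈ (a + b)
∈-+ˡ {b = b} {x} a≺b y∈b (member x∈a) = member (trans (bit-+ a≺b y∈b x) (cong (_∨ bit x b) x∈a))

∈-+ʳ : ∀ {a b x} → a ≺ b → x ∈ b → x ∈ (a + b)
∈-+ʳ {a} {x = x} a≺b x∈b =
  member (trans (bit-+ a≺b x∈b x) (trans (cong (bit x a ∨_) (bit-true x∈b)) (∨-zeroʳ (bit x a))))

∈-+⁻ : ∀ {a b x y} → a ≺ b → y ∈ b → x ∈ (a + b) → x ∈ a ⊎ x ∈ b
∈-+⁻ {a} {b} {x} a≺b y∈b (member x∈a+b) with bit x a in x∈a | bit x b in x∈b | trans (sym (bit-+ a≺b y∈b x)) x∈a+b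
... | true  | _    | _ = inj₁ (member x∈a)
... | false | true | _ = inj₂ (member x∈b)

lowest-+ : ∀ {a b x y} → a ≺ b → x ∈ a → y ∈ b → lowest (a + b) ≡ lowest a
lowest-+ {a} {b} a≺b x∈a y∈b = ≤-antisym (lowest-≤ (∈-+ˡ a≺b y∈b (lowest-∈ x∈a))) lowest-a≤
  where
  lowest-a≤ : lowest a ≤ lowest (a + b)
  lowest-a≤ with ∈-+⁻ a≺b y∈b (lowest-∈ (∈-+ˡ a≺b y∈b x∈a))
  ... | inj₁ in-a = lowest-≤ in-a
  ... | inj₂ in-b = <⇒≤ (a≺b (lowest-∈ x∈a) in-b)

highest-+ : ∀ {a b y} → a ≺ b → y ∈ b → highest (a + b) ≡ highest b
highest-+ {a} {b} a≺b y∈b = ≤-antisym highest≤ (≤highest (∈-+ʳ a≺b (highest-∈ y∈b)))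
  where
  highest≤ : highest (a + b) ≤ highest b
  highest≤ with ∈-+⁻ a≺b y∈b (highest-∈ (∈-+ʳ a≺b y∈b))
  ... | inj₁ in-a = <⇒≤ (a≺b in-a (highest-∈ y∈b))
  ... | inj₂ in-b = ≤highest in-b

_isLowestOf_ : ℕ → ℕ → Set
l isLowestOf x = l ∈ x × (∀ {y} → y < l → bit y x ≡ false)

lowest-isLowestOf : ∀ {x n} → x ∈ n → lowest n isLowestOf n
lowest-isLowestOf x∈n = lowest-∈ x∈n , <lowest⇒∉

isLowestOf-⌊/2⌋ : ∀ {l x} → suc l isLowestOf x → l isLowestOf ⌊ x /2⌋
isLowestOf-⌊/2⌋ (member l∈x , below) = member l∈x , λ y<l → below (s≤s y<l)

bits-+-≤commonLowest : ∀ {l x z} → l isLowestOf x → l isLowestOf z → ∀ {y} → y ≤ l → bit y (x + z) ≡ false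
bits-+-≤commonLowest {zero} {x} {z} (member odd-x , _) (member odd-z , _) z≤n
  rewrite odd?-+ x z | odd-x | odd-z = refl
bits-+-≤commonLowest {suc l} {x} {z} (_ , below-x) (_ , below-z) {zero} _
  rewrite odd?-+ x z | below-x {0} (s≤s z≤n) | below-z {0} (s≤s z≤n) = refl
bits-+-≤commonLowest {suc l} {x} lx lz@(_ , below-z) {suc y} y≤l =
  trans (cong (bit y) (⌊+/2⌋-even x (below-z (s≤s z≤n))))
        (bits-+-≤commonLowest (isLowestOf-⌊/2⌋ lx) (isLowestOf-⌊/2⌋ lz) (s≤s⁻¹ y≤l))

bit-+-commonLowest+1 : ∀ {l x z} → l isLowestOf x → l isLowestOf z →
                       bit (suc l) (x + z) ≡ not (bit (suc l) x xor bit (suc l) z)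
bit-+-commonLowest+1 {zero} {x} {z} (member odd-x , _) (member odd-z , _) =
  trans (cong odd? (⌊+/2⌋-odd x odd-x odd-z))
        (trans (odd?-suc (⌊ x /2⌋ + ⌊ z /2⌋)) (cong not (odd?-+ ⌊ x /2⌋ ⌊ z /2⌋)))
bit-+-commonLowest+1 {suc l} {x} lx lz@(_ , below-z) =
  trans (cong (bit (suc l)) (⌊+/2⌋-even x (below-z (s≤s z≤n))))
        (bit-+-commonLowest+1 (isLowestOf-⌊/2⌋ lx) (isLowestOf-⌊/2⌋ lz))

lowest-+-carry : ∀ {x z v w} → v ∈ x → w ∈ z → lowest x ≡ lowest z →
                 bit (suc (lowest x)) x ≡ bit (suc (lowest x)) z → lowest (x + z) ≡ suc (lowest x)
lowest-+-carry {x} {z} v∈x w∈z same equalBits =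
  ≤-antisym (lowest-≤ carry∈)
            (≮⇒≥ λ lt → true≢false (trans (sym (bit-true (lowest-∈ carry∈)))
                                          (bits-+-≤commonLowest x-lowest z-lowest (s≤s⁻¹ lt))))
  where
  x-lowest : lowest x isLowestOf x
  x-lowest = lowest-isLowestOf v∈x
  z-lowest : lowest x isLowestOf z
  z-lowest = subst (_isLowestOf z) (sym same) (lowest-isLowestOf w∈z)
  carry∈ : suc (lowest x) ∈ (x + z)
  carry∈ = member (trans (bit-+-commonLowest+1 x-lowest z-lowest)
                         (cong not (trans (cong (_xor b) equalBits) (xor-same b))))
    where
    b : Bool
    b = bit (suc (lowest x)) z

-- Block sequences

≡ᵇ-refl : ∀ n → (n ≡ᵇ n) ≡ true
≡ᵇ-refl n = Equivalence.to T-≡ (≡⇒≡ᵇ n n refl)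

-- The image of f, searching only indices below the argument: correct when i < f i for all i.
range : (ℕ → ℕ) → ℕ → Bool
range f y = any< (λ i → f i ≡ᵇ y) y

range-∋ : ∀ f {i} → i < f i → range f (f i) ≡ true
range-∋ f {i} i<fi = any<-intro (λ j → f j ≡ᵇ f i) (≡ᵇ-refl (f i)) i<fi

range-∈ : ∀ f {y} → range f y ≡ true → ∃ λ i → f i ≡ y
range-∈ f {y} y∈ with any<-elim (λ i → f i ≡ᵇ y) y y∈
... | i , fi≡y = i , ≡ᵇ⇒≡ (f i) y (Equivalence.from T-≡ fi≡y)

range-infinite : ∀ {f} → (∀ i → i < f i) → Infinite (range f)
range-infinite {f} inflationary n = f n , inflationary n , range-∋ f (inflationary n)

range-computable : ∀ {α f} → Computable₁ α f → Computable₁ α (λ y → b2n (range f y))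
range-computable {f = f} F = computable-ext (compose₂ (any<-computable hits-computable) π₀ π₀) λ { (y ∷ []) → refl }
  where
  hits-computable : ComputableRel _ (λ i y → f i ≡ᵇ y)
  hits-computable = computable-ext (compose₂ ≡ᵇ-computable (compose₁ F π₀) π₁) λ { (i ∷ y ∷ []) → refl }

consecutive⇒separated : ∀ {s : ℕ → ℕ} → (∀ i → ∃ λ x → x ∈ s i) → (∀ i → highest (s i) < lowest (s (suc i))) →
                        ∀ {i j} → i < j → s i ≺ s j
consecutive⇒separated {s} element step i<j x∈ y∈ = <-≤-trans (≤-<-trans (≤highest x∈) (gap i<j)) (lowest-≤ y∈)
  where
  gap : ∀ {i j} → i < j → highest (s i) < lowest (s j)
  gap {i} {suc j} i<1+j with m<1+n⇒m<n∨m≡n i<1+j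
  ... | inj₂ refl = step i
  ... | inj₁ i<j  = <-trans (<-≤-trans (gap i<j) (lowest≤highest (proj₂ (element j)))) (step j)

record BlockSequence (s : ℕ → ℕ) : Set where
  field
    nonempty  : ∀ i → s i ≢ 0
    positive  : ∀ i → bit 0 (s i) ≡ false
    separated : ∀ {i j} → i < j → s i ≺ s j

  element : ∀ i → ∃ λ x → x ∈ s i
  element i = nonzero⇒∈ (nonempty i)

  lowest∈ : ∀ i → lowest (s i) ∈ s i
  lowest∈ i = lowest-∈ (proj₂ (element i))

  highest∈ : ∀ i → highest (s i) ∈ s i
  highest∈ i = highest-∈ (proj₂ (element i))

  highest<lowest : ∀ {i j} → i < j → highest (s i) < lowest (s j)
  highest<lowest i<j = separated i<j (highest∈ _) (lowest∈ _)

  <lowest : ∀ i → i < lowest (s i)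
  <lowest zero    = n≢0⇒n>0 λ eq → true≢false (trans (sym (bit-true (subst (_∈ s 0) eq (lowest∈ 0)))) (positive 0))
  <lowest (suc i) = ≤-<-trans (≤-trans (<lowest i) (lowest≤highest (proj₂ (element i)))) (highest<lowest ≤-refl)

  <highest : ∀ i → i < highest (s i)
  <highest i = <-≤-trans (<lowest i) (lowest≤highest (proj₂ (element i)))

  distinct : ∀ {i j} → i < j → s i ≢ s j
  distinct {i} i<j eq = <-irrefl refl (subst (s i ≺_) (sym eq) (separated i<j) (lowest∈ i) (lowest∈ i))

minMaxColouring : (ℕ → ℕ → Bool) → ℕ → Bool
minMaxColouring c n = c (lowest n) (highest n)

minMaxColouring-computable : ∀ c → Computable₁ (encPairCol c) (λ n → b2n (minMaxColouring c n))
minMaxColouring-computable c =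
  computable-ext (compose₂ oracle-computable lowest-computable highest-computable) λ { (n ∷ []) → refl }

blocks⇒IPT : ∀ {α} c {s} k → BlockSequence s → Computable₁ α s →
             (∀ i → minMaxColouring c (s i) ≡ k) → (∀ {i j} → i < j → minMaxColouring c (s i + s j) ≡ k) →
             Σ (ℕ → Bool) λ H₁ → Σ (ℕ → Bool) λ H₂ → IPTSol c H₁ H₂ × Computes α (encSetPair H₁ H₂)
blocks⇒IPT c {s} k blocks s-computable single pair =
  range lo , range hi ,
  (range-infinite <lowest , refl , range-infinite <highest , refl , k , homogeneous) ,
  computable₂⇒computes (computable-ext
    (compose₃ ifNonzero-computable π₀ (compose₁ (range-computable (∘₁-computable highest-computable s-computable)) π₁)
                                      (compose₁ (range-computable (∘₁-computable lowest-computable s-computable)) π₁))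
    λ { (zero ∷ y ∷ []) → refl ; (suc _ ∷ y ∷ []) → refl })
  where
  open BlockSequence blocks
  lo hi : ℕ → ℕ
  lo i = lowest (s i)
  hi i = highest (s i)

  lo-hi-colour : ∀ {i j} → i ≤ j → c (lo i) (hi j) ≡ k
  lo-hi-colour {i} {j} i≤j with m≤n⇒m<n∨m≡n i≤j
  ... | inj₂ refl = single i
  ... | inj₁ i<j  = subst₂ (λ l h → c l h ≡ k) (lowest-+ (separated i<j) (lowest∈ i) (lowest∈ j))
                                             (highest-+ (separated i<j) (lowest∈ j)) (pair i<j)

  homogeneous : ∀ x₁ x₂ → range lo x₁ ≡ true → range hi x₂ ≡ true → x₁ < x₂ → c x₁ x₂ ≡ k
  homogeneous x₁ x₂ x₁∈ x₂∈ x₁<x₂ with range-∈ lo {x₁} x₁∈ | range-∈ hi {x₂} x₂∈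
  ... | i , refl | j , refl = lo-hi-colour (≮⇒≥ λ j<i → <-asym x₁<x₂ (highest<lowest j<i))

ipt≤FUT : IPT≤scFUT
ipt≤FUT c = minMaxColouring c , computable₂⇒computes colouring-computable , solution
  where
  colouring-computable : Computable₂ (encPairCol c) (λ n _ → b2n (minMaxColouring c n))
  colouring-computable = computable-ext (compose₁ (minMaxColouring-computable c) π₀) λ { (n ∷ _ ∷ []) → refl }

  solution : ∀ s → FUTSol (minMaxColouring c) s → Σ (ℕ → Bool) λ H₁ → Σ (ℕ → Bool) λ H₂ →
             IPTSol c H₁ H₂ × Computes (encFun s) (encSetPair H₁ H₂)
  solution s (nonempty , positive , separated , k , single , union) =
    blocks⇒IPT c k blocks (computable-ext (compose₂ oracle-computable π₀ zero-computable) λ { (i ∷ []) → refl })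
               single (λ i<j → union _ _ (<⇒≢ i<j) _ (bit-+ (BlockSequence.separated blocks i<j) (proj₂ (element _))))
    where
    blocks : BlockSequence s
    blocks = record { nonempty = nonempty ; positive = positive
                    ; separated = λ i<j (member x∈) (member y∈) → separated _ _ i<j _ _ x∈ y∈ }
    open BlockSequence blocks using (element)

-- Hindman's theorem

pairColour : Bool → Bool → Fin 4
pairColour false false = fzero
pairColour true  false = fsuc fzero
pairColour false true  = fsuc (fsuc fzero)
pairColour true  true  = fsuc (fsuc (fsuc fzero))

firstColour secondColour : Fin 4 → Bool
firstColour fzero                      = false
firstColour (fsuc fzero)               = true
firstColour (fsuc (fsuc fzero))        = false
firstColour (fsuc (fsuc (fsuc fzero))) = true
secondColour fzero                      = false
secondColour (fsuc fzero)               = false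
secondColour (fsuc (fsuc fzero))        = true
secondColour (fsuc (fsuc (fsuc fzero))) = true

firstColour-pair : ∀ a b → firstColour (pairColour a b) ≡ a
firstColour-pair false false = refl
firstColour-pair true  false = refl
firstColour-pair false true  = refl
firstColour-pair true  true  = refl

secondColour-pair : ∀ a b → secondColour (pairColour a b) ≡ b
secondColour-pair false false = refl
secondColour-pair true  false = refl
secondColour-pair false true  = refl
secondColour-pair true  true  = refl

toℕ-pairColour : ∀ a b → b2n a + (b2n b + b2n b) ≡ toℕ (pairColour a b)
toℕ-pairColour false false = refl
toℕ-pairColour true  false = refl
toℕ-pairColour false true  = refl
toℕ-pairColour true  true  = refl

hindmanColouring : (ℕ → ℕ → Bool) → ℕ → Fin 4
hindmanColouring c n = pairColour (minMaxColouring c n) (odd? (lowest n))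

hindmanColouring-computable : ∀ c → Computable₂ (encPairCol c) (λ n _ → toℕ (hindmanColouring c n))
hindmanColouring-computable c = computable-ext
  (compose₂ +-computable (compose₁ (minMaxColouring-computable c) π₀) (compose₂ +-computable parity parity))
  λ { (n ∷ _ ∷ []) → toℕ-pairColour (minMaxColouring c n) (odd? (lowest n)) }
  where
  parity : Computable (encPairCol c) 2 (λ xs → b2n (odd? (lowest (lookup xs fzero))))
  parity = compose₁ odd?-computable (compose₁ lowest-computable π₀)

no-three-distinct-Bools : ∀ {a b c : Bool} → a ≢ b → a ≢ c → b ≢ c → ⊥
no-three-distinct-Bools {false} {false}         a≢b _   _   = a≢b refl
no-three-distinct-Bools {true}  {true}          a≢b _   _   = a≢b refl
no-three-distinct-Bools {false} {true}  {false} _   a≢c _   = a≢c refl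
no-three-distinct-Bools {true}  {false} {true}  _   a≢c _   = a≢c refl
no-three-distinct-Bools {false} {true}  {true}  _   _   b≢c = b≢c refl
no-three-distinct-Bools {true}  {false} {false} _   _   b≢c = b≢c refl

∧-true⁻ : ∀ {p q} → (p ∧ q) ≡ true → p ≡ true × q ≡ true
∧-true⁻ {true} {true} _ = refl , refl

module HindmanSolution (c : ℕ → ℕ → Bool) (H : ℕ → Bool) (infinite : Infinite H) (positive : PosSet H)
  (k : Fin 4) (single : ∀ x → H x ≡ true → hindmanColouring c x ≡ k)
  (pair : ∀ x y → H x ≡ true → H y ≡ true → x ≢ y → hindmanColouring c (x + y) ≡ k) where

  element : ∀ {x} → H x ≡ true → ∃ λ y → y ∈ x
  element Hx = nonzero⇒∈ λ { refl → true≢false (trans (sym Hx) positive) }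

  colour : ∀ {x} → H x ≡ true → minMaxColouring c x ≡ firstColour k
  colour {x} Hx = trans (sym (firstColour-pair _ _)) (cong firstColour (single x Hx))

  colour-+ : ∀ {x y} → H x ≡ true → H y ≡ true → x ≢ y → minMaxColouring c (x + y) ≡ firstColour k
  colour-+ {x} {y} Hx Hy x≢y = trans (sym (firstColour-pair _ _)) (cong firstColour (pair x y Hx Hy x≢y))

  parity : ∀ {x} → H x ≡ true → odd? (lowest x) ≡ secondColour k
  parity {x} Hx = trans (sym (secondColour-pair _ _)) (cong secondColour (single x Hx))

  parity-+ : ∀ {x y} → H x ≡ true → H y ≡ true → x ≢ y → odd? (lowest (x + y)) ≡ secondColour k
  parity-+ {x} {y} Hx Hy x≢y = trans (sym (secondColour-pair _ _)) (cong secondColour (pair x y Hx Hy x≢y))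

  -- Otherwise x + y would have lowest element l + 1, of the wrong parity.
  nextBits-differ : ∀ {l x y} → H x ≡ true → H y ≡ true → x ≢ y → lowest x ≡ l → lowest y ≡ l →
                    bit (suc l) x ≢ bit (suc l) y
  nextBits-differ {x = x} {y} Hx Hy x≢y refl same equalBits = not-¬ refl (begin
    odd? (lowest x)             ≡⟨ parity Hx ⟩
    secondColour k              ≡⟨ parity-+ Hx Hy x≢y ⟨
    odd? (lowest (x + y))       ≡⟨ cong odd? (lowest-+-carry x∈ y∈ (sym same) equalBits) ⟩
    odd? (suc (lowest x))       ≡⟨ odd?-suc (lowest x) ⟩
    not (odd? (lowest x))       ∎)
    where
    open ≡-Reasoning
    x∈ : proj₁ (element Hx) ∈ x
    x∈ = proj₂ (element Hx)
    y∈ : proj₁ (element Hy) ∈ y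
    y∈ = proj₂ (element Hy)

  lowest-unbounded : ∀ M n → ∃ λ x → n < x × H x ≡ true × M ≤ lowest x
  lowest-unbounded zero n with infinite n
  ... | x , n<x , Hx = x , n<x , Hx , z≤n
  lowest-unbounded (suc M) n with lowest-unbounded M n
  ... | x₁ , n<x₁ , H₁ , M≤₁ with lowest-unbounded M x₁
  ... | x₂ , x₁<x₂ , H₂ , M≤₂ with lowest-unbounded M x₂
  ... | x₃ , x₂<x₃ , H₃ , M≤₃ with m≤n⇒m<n∨m≡n M≤₁ | m≤n⇒m<n∨m≡n M≤₂ | m≤n⇒m<n∨m≡n M≤₃
  ... | inj₁ M<₁ | _        | _        = x₁ , n<x₁ , H₁ , M<₁
  ... | inj₂ _   | inj₁ M<₂ | _        = x₂ , <-trans n<x₁ x₁<x₂ , H₂ , M<₂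
  ... | inj₂ _   | inj₂ _   | inj₁ M<₃ = x₃ , <-trans (<-trans n<x₁ x₁<x₂) x₂<x₃ , H₃ , M<₃
  ... | inj₂ M≡₁ | inj₂ M≡₂ | inj₂ M≡₃ = ⊥-elim (no-three-distinct-Bools
        (nextBits-differ H₁ H₂ (<⇒≢ x₁<x₂) (sym M≡₁) (sym M≡₂))
        (nextBits-differ H₁ H₃ (<⇒≢ (<-trans x₁<x₂ x₂<x₃)) (sym M≡₁) (sym M≡₃))
        (nextBits-differ H₂ H₃ (<⇒≢ x₂<x₃) (sym M≡₂) (sym M≡₃)))

  above : ℕ → ℕ → Bool
  above L x = H x ∧ (L <ᵇ lowest x)

  searchBound : ℕ → ℕ
  searchBound L = suc (proj₁ (lowest-unbounded (suc L) 0))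

  next : ℕ → ℕ
  next L = least (above L) (searchBound L)

  next-above : ∀ L → above L (next L) ≡ true
  next-above L with lowest-unbounded (suc L) 0
  ... | x , _ , Hx , L<lowest = least-found (above L) x-above ≤-refl
    where
    x-above : above L x ≡ true
    x-above rewrite Hx = Equivalence.to T-≡ (<⇒<ᵇ L<lowest)

  next-minimal : ∀ L i → i < next L → above L i ≡ false
  next-minimal L i = least-minimal (above L) (searchBound L) i

  next-∈ : ∀ L → H (next L) ≡ true
  next-∈ L = proj₁ (∧-true⁻ (next-above L))

  <lowest-next : ∀ L → L < lowest (next L)
  <lowest-next L = <ᵇ⇒< L _ (Equivalence.from T-≡ (proj₂ (∧-true⁻ (next-above L))))

  blocks : ℕ → ℕ
  blocks zero    = next 0
  blocks (suc i) = next (highest (blocks i))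

  blocks-∈ : ∀ i → H (blocks i) ≡ true
  blocks-∈ zero    = next-∈ 0
  blocks-∈ (suc i) = next-∈ (highest (blocks i))

  blocks-sequence : BlockSequence blocks
  blocks-sequence = record
    { nonempty  = λ i eq → true≢false (trans (sym (blocks-∈ i)) (trans (cong H eq) positive))
    ; positive  = λ i → <lowest⇒∉ {n = blocks i} (lowest-positive i)
    ; separated = consecutive⇒separated (λ i → element (blocks-∈ i)) (λ i → <lowest-next (highest (blocks i)))
    }
    where
    lowest-positive : ∀ i → 0 < lowest (blocks i)
    lowest-positive zero    = <lowest-next 0
    lowest-positive (suc i) = ≤-<-trans z≤n (<lowest-next (highest (blocks i)))

  blocks-computable : Computable₁ (encSet H) blocks
  blocks-computable = recursion₁-computable blocks (compose₁ next-computable zero-computable)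
                        (compose₁ next-computable (compose₁ highest-computable π₁)) refl (λ _ → refl)
    where
    above-computable : ComputableRel (encSet H) (λ x L → above L x)
    above-computable = computable-ext
      (∧-computable (compose₂ oracle-computable π₀ zero-computable)
                    (compose₂ <ᵇ-computable π₁ (compose₁ lowest-computable π₀)))
      λ { (x ∷ L ∷ []) → refl }
    next-computable : Computable₁ (encSet H) next
    next-computable = search-computable above-computable next next-above next-minimal

ipt≤HT : IPT≤scHT
ipt≤HT c = hindmanColouring c , computable₂⇒computes (hindmanColouring-computable c) , solution
  where
  solution : ∀ H → HTSol (hindmanColouring c) H → Σ (ℕ → Bool) λ H₁ → Σ (ℕ → Bool) λ H₂ →
             IPTSol c H₁ H₂ × Computes (encSet H) (encSetPair H₁ H₂)
  solution H (infinite , positive , k , single , pair) =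
    blocks⇒IPT c (firstColour k) blocks-sequence blocks-computable
      (λ i → colour (blocks-∈ i))
      (λ {i} {j} i<j → colour-+ (blocks-∈ i) (blocks-∈ j) (BlockSequence.distinct blocks-sequence i<j))
    where open HindmanSolution c H infinite positive k single pair

corollary2 : IPT≤scFUT × IPT≤scHT
corollary2 = ipt≤FUT , ipt≤HT
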